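{- There exists $\varepsilon_0>0$ such that for every $\varepsilon\in(0,\varepsilon_0)$, setting $c=4.383-\varepsilon$, the following holds. Let $n\ge1$ and let $P$ be the path with vertices $v_0,v_1,\dots,v_n$ and edges $v_iv_{i+1}$ ($0\le i<n$), and let $B=\{v_0\}$. Fix $j\in\mathbb{Z}$ and let $T'(n)$ be the number of prototypes $(A,f)$ (of $P$ with respect to $B$) satisfying $v_0\notin A$ and $f(v_0)=j$. Then $T'(n)\le 3\cdot c^{n-1}$.
   Context: Let $G=(V,E)$ be a graph. For $A\subseteq V$ and $f:A\to\mathbb{Z}$, a bucket extension of $f$ is $\bar f:V\to\mathbb{Z}$ with: (1) $\bar f|_A=f$; (2) $|\bar f(u)-\bar f(v)|\le1$ for every edge $uv$; (3) $\bar f(u)\ge\bar f(v)$ for every edge $uv$ with $u\in A$, $v\notin A$. $(A,f)$ is a partial bucket function if $f$ has a bucket extension. For a fixed $B\subseteq V$, a prototype is a pair $(A,f)$ with $A\subseteq V$ and $f:A\cup B\to\mathbb{Z}$ such that $(A,f|_A)$ is a partial bucket function and there exists a bucket extension $\bar f$ of $f|_A$ with $\bar f|_{A\cup B}=f$.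
   Formalization: The parameter ε ranges over the rationals, and the constant ε₀ is also taken rational. -}

module Defs where

open import Data.Nat as ℕ using (ℕ; zero; suc)
open import Data.Integer as ℤ using (ℤ; _-_; ∣_∣)
open import Data.Rational as ℚ using (ℚ; 1ℚ)
open import Data.Fin using (Fin; zero; toℕ)
open import Data.Fin.Subset using (Subset; _∈_; _∉_; _∪_; ⁅_⁆; inside; outside)
open import Data.Vec using (Vec; lookup; tabulate)
open import Data.Maybe using (Maybe; just; nothing)
open import Data.Bool using (if_then_else_)
open import Data.Product using (Σ; ∃; _×_; _,_)
open import Data.Sum using (_⊎_)
open import Relation.Binary.PropositionalEquality using (_≡_)

-- Graphs on the vertex set Fin m, given by an adjacency relation Adj
-- (Adj u v means uv is an edge; for undirected graphs Adj is symmetric).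
Graph : ℕ → Set₁
Graph m = Fin m → Fin m → Set

-- A partial integer-valued function on Fin m is a vector of Maybe ℤ;
-- its domain is the set of vertices where it is 'just'.
PFun : ℕ → Set
PFun m = Vec (Maybe ℤ) m

Defined : ∀ {m} → PFun m → Fin m → Set
Defined f i = ∃ λ z → lookup f i ≡ just z

HasDomain : ∀ {m} → Subset m → PFun m → Set
HasDomain D f = ∀ i → (i ∈ D → Defined f i) × (Defined f i → i ∈ D)

restrict : ∀ {m} → Subset m → PFun m → PFun m
restrict A f = tabulate λ i → if lookup A i then lookup f i else nothing

IsBucketExtension : ∀ {m} → Graph m → Subset m → PFun m → (Fin m → ℤ) → Set
IsBucketExtension G A f fbar =
  (∀ i → i ∈ A → lookup f i ≡ just (fbar i)) ×
  (∀ u v → G u v → ∣ fbar u - fbar v ∣ ℕ.≤ 1) ×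
  (∀ u v → G u v → u ∈ A → v ∉ A → fbar v ℤ.≤ fbar u)

IsPartialBucketFunction : ∀ {m} → Graph m → Subset m → PFun m → Set
IsPartialBucketFunction G A f =
  HasDomain A f × Σ (Fin _ → ℤ) (IsBucketExtension G A f)

IsPrototype : ∀ {m} → Graph m → Subset m → Subset m → PFun m → Set
IsPrototype G B A f =
  HasDomain (A ∪ B) f ×
  IsPartialBucketFunction G A (restrict A f) ×
  Σ (Fin _ → ℤ) λ fbar →
    IsBucketExtension G A (restrict A f) fbar ×
    (∀ i → i ∈ (A ∪ B) → lookup f i ≡ just (fbar i))

PathGraph : (n : ℕ) → Graph (suc n)
PathGraph n u v = (toℕ v ≡ suc (toℕ u)) ⊎ (toℕ u ≡ suc (toℕ v))

IsT'Prototype : (n : ℕ) → ℤ → Subset (suc n) × PFun (suc n) → Set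
IsT'Prototype n j (A , f) =
  IsPrototype (PathGraph n) ⁅ zero ⁆ A f ×
  zero ∉ A ×
  lookup f zero ≡ just j

_^ℚ_ : ℚ → ℕ → ℚ
q ^ℚ zero = 1ℚ
q ^ℚ suc k = q ℚ.* (q ^ℚ k)

module Submission where

open import Defs
open import Data.Nat as ℕ using (ℕ; suc; _∸_)
open import Data.Integer as ℤ using (ℤ; +_)
open import Data.Rational as ℚ using (ℚ; 0ℚ; _/_)
open import Data.Fin.Subset using (Subset)
open import Data.List using (List; length)
open import Data.List.Relation.Unary.All using (All)
open import Data.List.Relation.Unary.Unique.Propositional using (Unique)
open import Data.Product using (Σ; _×_)

open import Data.Nat using (zero; z≤n; s≤s; _+_; _*_; _^_; _≤_; _<_)
import Data.Nat.Properties as ℕP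
import Data.Nat.Tactic.RingSolver as ℕSolver
open import Data.Integer using (-[1+_]; 1ℤ; -1ℤ; _-_; ∣_∣)
import Data.Integer.Properties as ℤP
import Data.Integer.Tactic.RingSolver as ℤSolver
import Data.Rational.Properties as ℚP
import Data.Rational.Unnormalised as ℚᵘ
import Data.Rational.Unnormalised.Properties as ℚᵘP
open import Data.Bool using (Bool; true; false; if_then_else_)
open import Data.Maybe using (Maybe; just; nothing)
import Data.Maybe.Properties as MaybeP
open import Data.Vec using (Vec; []; _∷_; lookup; head; tail)
import Data.Vec.Properties as VecP
open import Data.Fin using (Fin; zero; suc; toℕ)
open import Data.Fin.Subset using (_∪_; ⁅_⁆) renaming (_∈_ to _∈ₛ_; _∉_ to _∉ₛ_)
import Data.Fin.Subset.Properties as SubsetP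
open import Data.List using ([]; _∷_; _++_; map; [_])
import Data.List.Properties as ListP
import Data.List.Relation.Unary.All as All
open import Data.List.Relation.Unary.AllPairs using (_∷_)
open import Data.List.Relation.Unary.Any using (here; there)
open import Data.List.Relation.Binary.Subset.Propositional using (_⊆_)
open import Data.List.Membership.Propositional using (_∈_)
open import Data.List.Membership.Propositional.Properties using (∈-++⁺ˡ; ∈-++⁺ʳ; ∈-++⁻; ∈-map⁺; ∈-∃++)
open import Data.Product using (_,_; proj₂)
open import Data.Sum using (_⊎_; inj₁; inj₂)
open import Data.Unit using (⊤; tt)
open import Data.Empty using (⊥-elim)
open import Relation.Nullary using (¬_)
open import Function using (_∘_)
open import Relation.Binary.PropositionalEquality
  using (_≡_; refl; sym; trans; cong; cong₂; subst; subst₂; module ≡-Reasoning)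

-- Let (A, f) be a T'-prototype of the path v₀ … vₙ and fbar a
-- bucket extension witnessing it.  Then f(v₀) = j, and on v₁ … vₙ the
-- function f is fbar on A and undefined off A, so (A, f) is determined by the
-- pattern (A, f|A).  Walking along the path, consecutive values of fbar differ
-- by at most one, and across a boundary of A the vertex in A carries the
-- larger value.  So it suffices to remember whether the current vertex is in
-- A together with its value (inside A) or an interval of integers containing
-- its value (outside A, where the value is not recorded).  This gives explicit
-- lists 'tailsIn' / 'tailsOut' of candidate patterns which contain every
-- prototype ('prototype-listed') and whose lengths '#in' / '#out' obey a
-- linear recursion.  A joint induction bounds them by 0.84·cᵏ and
-- (0.69 + 0.27·w)·cᵏ for c = 4.373, which yields T'(n) ≤ 3·4.373ⁿ⁻¹.  Since a
-- duplicate-free list contained in another list is not longer, and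
-- 4.373 ≤ 4.383 - ε whenever ε < 1/100, lemma16 follows with ε₀ = 1/100.

unit-distance : ∀ x y → ∣ x - y ∣ ≤ 1 → y ≡ x - 1ℤ ⊎ y ≡ x ⊎ y ≡ x ℤ.+ 1ℤ
unit-distance x y = by-difference (x - y) refl
  where
  y≡x-[x-y] : ∀ x y → y ≡ x - (x - y)
  y≡x-[x-y] = ℤSolver.solve-∀
  x--1≡x+1 : ∀ x → x - -1ℤ ≡ x ℤ.+ 1ℤ
  x--1≡x+1 = ℤSolver.solve-∀
  y≡x-difference : ∀ {z} → x - y ≡ z → y ≡ x - z
  y≡x-difference eq = trans (y≡x-[x-y] x y) (cong (x -_) eq)
  by-difference : ∀ z → x - y ≡ z → ∣ z ∣ ≤ 1 → y ≡ x - 1ℤ ⊎ y ≡ x ⊎ y ≡ x ℤ.+ 1ℤ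
  by-difference (+ 0)             eq _         = inj₂ (inj₁ (trans (y≡x-difference eq) (ℤP.+-identityʳ x)))
  by-difference (+ 1)             eq _         = inj₁ (y≡x-difference eq)
  by-difference -[1+ 0 ]          eq _         = inj₂ (inj₂ (trans (y≡x-difference eq) (x--1≡x+1 x)))
  by-difference (+ suc (suc _))   _  (s≤s ())
  by-difference -[1+ suc _ ]      _  (s≤s ())

¬x≤x-1 : ∀ x → ¬ (x ℤ.≤ x - 1ℤ)
¬x≤x-1 x h = ℤP.<-irrefl refl (ℤP.i≤pred[j]⇒i<j (subst (x ℤ.≤_) (ℤP.+-comm x -1ℤ) h))

¬x+1≤x : ∀ x → ¬ (x ℤ.+ 1ℤ ℤ.≤ x)
¬x+1≤x x h = ℤP.<-irrefl refl (ℤP.suc[i]≤j⇒i<j (subst (ℤ._≤ x) (ℤP.+-comm x 1ℤ) h))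

-- The window of width k at lo is {lo, lo + 1, …, lo + (k - 1)}; a proof of
-- 'y ≡ lo + + i' with i < k places y in it.

private
  x-1-index : ∀ lo K → (lo ℤ.+ K) - 1ℤ ≡ (lo - 1ℤ) ℤ.+ K
  x-1-index = ℤSolver.solve-∀
  x-index : ∀ lo K → lo ℤ.+ K ≡ (lo - 1ℤ) ℤ.+ (1ℤ ℤ.+ K)
  x-index = ℤSolver.solve-∀
  x+1-index : ∀ lo K → (lo ℤ.+ K) ℤ.+ 1ℤ ≡ (lo - 1ℤ) ℤ.+ (1ℤ ℤ.+ (1ℤ ℤ.+ K))
  x+1-index = ℤSolver.solve-∀
  x+1-index′ : ∀ lo K → (lo ℤ.+ K) ℤ.+ 1ℤ ≡ lo ℤ.+ (1ℤ ℤ.+ K)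
  x+1-index′ = ℤSolver.solve-∀

neighbour-index : ∀ lo k x y → x ≡ lo ℤ.+ + k → ∣ x - y ∣ ≤ 1 →
                  Σ ℕ λ i → i ≤ 2 + k × y ≡ (lo - 1ℤ) ℤ.+ + i
neighbour-index lo k x y refl d with unit-distance x y d
... | inj₁ y≡x-1        = k , ℕP.m≤n+m k 2 , trans y≡x-1 (x-1-index lo (+ k))
... | inj₂ (inj₁ y≡x)   = suc k , ℕP.m≤n+m (suc k) 1 , trans y≡x (x-index lo (+ k))
... | inj₂ (inj₂ y≡x+1) = 2 + k , ℕP.≤-refl , trans y≡x+1 (x+1-index lo (+ k))

lower-neighbour-index : ∀ lo k x y → x ≡ lo ℤ.+ + k → ∣ x - y ∣ ≤ 1 → y ℤ.≤ x →
                        Σ ℕ λ i → i ≤ 1 + k × y ≡ (lo - 1ℤ) ℤ.+ + i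
lower-neighbour-index lo k x y refl d y≤x with unit-distance x y d
... | inj₁ y≡x-1        = k , ℕP.n≤1+n k , trans y≡x-1 (x-1-index lo (+ k))
... | inj₂ (inj₁ y≡x)   = suc k , ℕP.≤-refl , trans y≡x (x-index lo (+ k))
... | inj₂ (inj₂ refl)  = ⊥-elim (¬x+1≤x x y≤x)

upper-neighbour-index : ∀ lo k x y → x ≡ lo ℤ.+ + k → ∣ x - y ∣ ≤ 1 → x ℤ.≤ y →
                        Σ ℕ λ i → i ≤ 1 + k × y ≡ lo ℤ.+ + i
upper-neighbour-index lo k x y refl d x≤y with unit-distance x y d
... | inj₁ refl         = ⊥-elim (¬x≤x-1 x x≤y)
... | inj₂ (inj₁ y≡x)   = k , ℕP.n≤1+n k , y≡x
... | inj₂ (inj₂ y≡x+1) = suc k , ℕP.≤-refl , trans y≡x+1 (x+1-index′ lo (+ k))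

overWindow : {X : Set} → (ℤ → List X) → ℤ → ℕ → List X
overWindow h lo zero    = []
overWindow h lo (suc k) = h lo ++ overWindow h (lo ℤ.+ 1ℤ) k

∈-overWindow : {X : Set} (h : ℤ → List X) (lo : ℤ) (k i : ℕ) {y : ℤ} {p : X} →
               i < k → y ≡ lo ℤ.+ + i → p ∈ h y → p ∈ overWindow h lo k
∈-overWindow h lo (suc k) zero    _         refl p∈ = ∈-++⁺ˡ (subst (λ z → _ ∈ h z) (ℤP.+-identityʳ lo) p∈)
∈-overWindow h lo (suc k) (suc i) (s≤s i<k) refl p∈ =
  ∈-++⁺ʳ (h lo) (∈-overWindow h (lo ℤ.+ 1ℤ) k i i<k (shift lo (+ i)) p∈)
  where
  shift : ∀ lo I → lo ℤ.+ (1ℤ ℤ.+ I) ≡ (lo ℤ.+ 1ℤ) ℤ.+ I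
  shift = ℤSolver.solve-∀

length-overWindow : {X : Set} (h : ℤ → List X) (ℓ : ℕ) → (∀ y → length (h y) ≡ ℓ) →
                    ∀ lo k → length (overWindow h lo k) ≡ k * ℓ
length-overWindow h ℓ hℓ lo zero    = refl
length-overWindow h ℓ hℓ lo (suc k) =
  trans (ListP.length-++ (h lo)) (cong₂ _+_ (hℓ lo) (length-overWindow h ℓ hℓ _ k))

unique-⊆-length : {X : Set} (L M : List X) → Unique L → L ⊆ M → length L ≤ length M
unique-⊆-length []      M _          _   = z≤n
unique-⊆-length (x ∷ L) M (x∉L ∷ uL) L⊆M with ∈-∃++ (L⊆M (here refl))
... | M₁ , M₂ , refl =
  ℕP.≤-trans (s≤s (unique-⊆-length L (M₁ ++ M₂) uL L⊆M₁M₂))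
             (ℕP.≤-reflexive (sym (ListP.length-++-sucʳ M₁ x M₂)))
  where
  L⊆M₁M₂ : L ⊆ M₁ ++ M₂
  L⊆M₁M₂ {y} y∈L with ∈-++⁻ M₁ (L⊆M (there y∈L))
  ... | inj₁ y∈M₁          = ∈-++⁺ˡ y∈M₁
  ... | inj₂ (here y≡x)    = ⊥-elim (All.lookup x∉L y∈L (sym y≡x))
  ... | inj₂ (there y∈M₂)  = ∈-++⁺ʳ M₁ y∈M₂

-- Patterns along a stretch of m consecutive path vertices: which of them lie
-- in A, and the values of f on them.
Pattern : ℕ → Set
Pattern m = Vec Bool m × Vec (Maybe ℤ) m

consIn : ∀ {m} → ℤ → Pattern m → Pattern (suc m)
consIn y (A , f) = (true ∷ A , just y ∷ f)

consOut : ∀ {m} → Pattern m → Pattern (suc m)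
consOut (A , f) = (false ∷ A , nothing ∷ f)

-- Walk b x m A f g: the values g on a stretch of m vertices with pattern
-- (A, f) continue a bucket extension past a vertex of value x that lies in A
-- iff b.
Walk : Bool → ℤ → (m : ℕ) → Vec Bool m → Vec (Maybe ℤ) m → (Fin m → ℤ) → Set
Walk b x zero    []           []       g = ⊤
Walk b x (suc m) (true ∷ A)  (f₀ ∷ f) g =
  f₀ ≡ just (g zero) × ∣ x - g zero ∣ ≤ 1 × (b ≡ false → x ℤ.≤ g zero) ×
  Walk true (g zero) m A f (g ∘ suc)
Walk b x (suc m) (false ∷ A) (f₀ ∷ f) g =
  f₀ ≡ nothing × ∣ x - g zero ∣ ≤ 1 × (b ≡ true → g zero ℤ.≤ x) ×
  Walk false (g zero) m A f (g ∘ suc)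

mutual
  -- Candidate patterns of length m following a vertex of A with value a:
  -- the next vertex is in A with value in {a - 1, a, a + 1}, or outside A
  -- with value in {a - 1, a}.
  tailsIn : ℤ → (m : ℕ) → List (Pattern m)
  tailsIn a zero    = [ ([] , []) ]
  tailsIn a (suc m) = overWindow (startIn m) (a - 1ℤ) 3 ++ map consOut (tailsOut (a - 1ℤ) 1 m)

  -- Candidate patterns of length m following a vertex outside A whose value
  -- lies in the window of width 1 + w at lo: the next vertex is in A with
  -- value in the window of width 2 + w at lo, or outside A with value in the
  -- window of width 3 + w at lo - 1.
  tailsOut : ℤ → ℕ → (m : ℕ) → List (Pattern m)
  tailsOut lo w zero    = [ ([] , []) ]
  tailsOut lo w (suc m) = overWindow (startIn m) lo (2 + w) ++ map consOut (tailsOut (lo - 1ℤ) (2 + w) m)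

  startIn : (m : ℕ) → ℤ → List (Pattern (suc m))
  startIn m y = map (consIn y) (tailsIn y m)

mutual
  tailsIn-complete : ∀ m a A f g → Walk true a m A f g → (A , f) ∈ tailsIn a m
  tailsIn-complete zero a [] [] g _ = here refl
  tailsIn-complete (suc m) a (true ∷ A) (_ ∷ f) g (refl , d , _ , walk)
    with neighbour-index a 0 a (g zero) (sym (ℤP.+-identityʳ a)) d
  ... | i , i≤2 , y≡ =
    ∈-++⁺ˡ (∈-overWindow (startIn m) (a - 1ℤ) 3 i (s≤s i≤2) y≡
             (∈-map⁺ (consIn (g zero)) (tailsIn-complete m (g zero) A f (g ∘ suc) walk)))
  tailsIn-complete (suc m) a (false ∷ A) (_ ∷ f) g (refl , d , down , walk)
    with lower-neighbour-index a 0 a (g zero) (sym (ℤP.+-identityʳ a)) d (down refl)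
  ... | i , i≤1 , y≡ =
    ∈-++⁺ʳ (overWindow (startIn m) (a - 1ℤ) 3)
      (∈-map⁺ consOut (tailsOut-complete m (a - 1ℤ) 1 i A f (g ∘ suc) (g zero) y≡ i≤1 walk))

  tailsOut-complete : ∀ m lo w k A f g x → x ≡ lo ℤ.+ + k → k ≤ w →
                      Walk false x m A f g → (A , f) ∈ tailsOut lo w m
  tailsOut-complete zero lo w k [] [] g x _ _ _ = here refl
  tailsOut-complete (suc m) lo w k (true ∷ A) (_ ∷ f) g x x≡ k≤w (refl , d , up , walk)
    with upper-neighbour-index lo k x (g zero) x≡ d (up refl)
  ... | i , i≤1+k , y≡ =
    ∈-++⁺ˡ (∈-overWindow (startIn m) lo (2 + w) i (s≤s (ℕP.≤-trans i≤1+k (s≤s k≤w))) y≡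
             (∈-map⁺ (consIn (g zero)) (tailsIn-complete m (g zero) A f (g ∘ suc) walk)))
  tailsOut-complete (suc m) lo w k (false ∷ A) (_ ∷ f) g x x≡ k≤w (refl , d , _ , walk)
    with neighbour-index lo k x (g zero) x≡ d
  ... | i , i≤2+k , y≡ =
    ∈-++⁺ʳ (overWindow (startIn m) lo (2 + w))
      (∈-map⁺ consOut (tailsOut-complete m (lo - 1ℤ) (2 + w) i A f (g ∘ suc) (g zero) y≡
                         (ℕP.≤-trans i≤2+k (ℕP.+-monoʳ-≤ 2 k≤w)) walk))

mutual
  #in : ℕ → ℕ
  #in zero    = 1
  #in (suc m) = 3 * #in m + #out 1 m

  #out : ℕ → ℕ → ℕ
  #out w zero    = 1
  #out w (suc m) = (2 + w) * #in m + #out (2 + w) m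

mutual
  length-tailsIn : ∀ a m → length (tailsIn a m) ≡ #in m
  length-tailsIn a zero    = refl
  length-tailsIn a (suc m) =
    trans (ListP.length-++ (overWindow (startIn m) (a - 1ℤ) 3))
          (cong₂ _+_ (length-overWindow (startIn m) (#in m) (length-startIn m) (a - 1ℤ) 3)
                     (length-consOut (a - 1ℤ) 1 m))

  length-tailsOut : ∀ lo w m → length (tailsOut lo w m) ≡ #out w m
  length-tailsOut lo w zero    = refl
  length-tailsOut lo w (suc m) =
    trans (ListP.length-++ (overWindow (startIn m) lo (2 + w)))
          (cong₂ _+_ (length-overWindow (startIn m) (#in m) (length-startIn m) lo (2 + w))
                     (length-consOut (lo - 1ℤ) (2 + w) m))

  length-startIn : ∀ m y → length (startIn m y) ≡ #in m
  length-startIn m y = trans (ListP.length-map (consIn y) (tailsIn y m)) (length-tailsIn y m)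

  length-consOut : ∀ lo w m → length (map consOut (tailsOut lo w m)) ≡ #out w m
  length-consOut lo w m = trans (ListP.length-map consOut (tailsOut lo w m)) (length-tailsOut lo w m)

-- The growth rate c = p / d = 4.373 of the candidate counts.  The numerals
-- are kept opaque so that the type checker does not expand products of them;
-- closed numeric facts about p and d are transported from the literals.
opaque
  p d : ℕ
  p = 4373
  d = 1000

  p≡4373 : p ≡ 4373
  p≡4373 = refl

  d≡1000 : d ≡ 1000
  d≡1000 = refl

numerals : (P : ℕ → ℕ → Set) → P 4373 1000 → P p d
numerals P = subst₂ P (sym p≡4373) (sym d≡1000)

-- The bounds #in k ≤ 0.84·cᵏ and #out w k ≤ (0.69 + 0.27·w)·cᵏ, cleared of
-- denominators.  They hold for k ≥ 2 and are preserved by the recursion.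
InBound : ℕ → Set
InBound k = 100 * d ^ k * #in k ≤ 84 * p ^ k

OutBound : ℕ → Set
OutBound k = ∀ w → 100 * d ^ k * #out w k ≤ (69 + 27 * w) * p ^ k

-- Numeric step for #in: 3·0.84 + (0.69 + 0.27) ≤ 0.84·c.
in-step : ∀ Y X a b → 100 * Y * a ≤ 84 * X → 100 * Y * b ≤ (69 + 27 * 1) * X →
          100 * (d * Y) * (3 * a + b) ≤ 84 * (p * X)
in-step Y X a b ha hb = begin
  100 * (d * Y) * (3 * a + b)              ≡⟨ regroup d Y a b ⟩
  d * (3 * (100 * Y * a) + 100 * Y * b)    ≤⟨ ℕP.*-monoʳ-≤ d (ℕP.+-mono-≤ (ℕP.*-monoʳ-≤ 3 ha) hb) ⟩
  d * (3 * (84 * X) + (69 + 27 * 1) * X)   ≡⟨ collect d X ⟩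
  (348 * d) * X                            ≤⟨ ℕP.*-monoˡ-≤ X (numerals (λ p d → 348 * d ≤ 84 * p) (ℕP.≤ᵇ⇒≤ _ _ tt)) ⟩
  (84 * p) * X                             ≡⟨ ℕP.*-assoc 84 p X ⟩
  84 * (p * X)                             ∎
  where
  open ℕP.≤-Reasoning
  regroup : ∀ D Y a b → 100 * (D * Y) * (3 * a + b) ≡ D * (3 * (100 * Y * a) + 100 * Y * b)
  regroup = ℕSolver.solve-∀
  collect : ∀ D X → D * (3 * (84 * X) + (69 + 27 * 1) * X) ≡ (348 * D) * X
  collect = ℕSolver.solve-∀

-- Numeric step for #out w: (2 + w)·0.84 + 0.69 + 0.27·(2 + w) ≤ (0.69 + 0.27·w)·c.
out-step : ∀ Y X w a b → 100 * Y * a ≤ 84 * X → 100 * Y * b ≤ (69 + 27 * (2 + w)) * X →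
           100 * (d * Y) * ((2 + w) * a + b) ≤ (69 + 27 * w) * (p * X)
out-step Y X w a b ha hb = begin
  100 * (d * Y) * ((2 + w) * a + b)                    ≡⟨ regroup d Y w a b ⟩
  d * ((2 + w) * (100 * Y * a) + 100 * Y * b)          ≤⟨ ℕP.*-monoʳ-≤ d (ℕP.+-mono-≤ (ℕP.*-monoʳ-≤ (2 + w) ha) hb) ⟩
  d * ((2 + w) * (84 * X) + (69 + 27 * (2 + w)) * X)   ≡⟨ collect d X w ⟩
  (291 * d + (111 * d) * w) * X                        ≤⟨ ℕP.*-monoˡ-≤ X (ℕP.+-mono-≤ constant slope) ⟩
  (69 * p + (27 * p) * w) * X                          ≡⟨ factor p X w ⟩
  (69 + 27 * w) * (p * X)                              ∎
  where
  open ℕP.≤-Reasoning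
  constant : 291 * d ≤ 69 * p
  constant = numerals (λ p d → 291 * d ≤ 69 * p) (ℕP.≤ᵇ⇒≤ _ _ tt)
  slope : (111 * d) * w ≤ (27 * p) * w
  slope = ℕP.*-monoˡ-≤ w (numerals (λ p d → 111 * d ≤ 27 * p) (ℕP.≤ᵇ⇒≤ _ _ tt))
  regroup : ∀ D Y w a b → 100 * (D * Y) * ((2 + w) * a + b) ≡ D * ((2 + w) * (100 * Y * a) + 100 * Y * b)
  regroup = ℕSolver.solve-∀
  collect : ∀ D X w → D * ((2 + w) * (84 * X) + (69 + 27 * (2 + w)) * X) ≡ (291 * D + (111 * D) * w) * X
  collect = ℕSolver.solve-∀
  factor : ∀ P X w → (69 * P + (27 * P) * w) * X ≡ (69 + 27 * w) * (P * X)
  factor = ℕSolver.solve-∀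

-- Base case k = 2, where #in 2 = 16 and #out w 2 = 5·w + 13.
bounds-base : InBound 2 × OutBound 2
bounds-base = numerals (λ p d → 100 * d ^ 2 * 16 ≤ 84 * p ^ 2) (ℕP.≤ᵇ⇒≤ _ _ tt) , out-base
  where
  open ℕP.≤-Reasoning
  out-base : OutBound 2
  out-base w = begin
    100 * d ^ 2 * #out w 2                       ≡⟨ expand d w ⟩
    (500 * (d * d)) * w + 1300 * (d * d)         ≤⟨ ℕP.+-mono-≤ (ℕP.*-monoˡ-≤ w (numerals (λ p d → 500 * (d * d) ≤ 27 * (p * p)) (ℕP.≤ᵇ⇒≤ _ _ tt)))
                                                                (numerals (λ p d → 1300 * (d * d) ≤ 69 * (p * p)) (ℕP.≤ᵇ⇒≤ _ _ tt)) ⟩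
    (27 * (p * p)) * w + 69 * (p * p)            ≡⟨ factor p w ⟩
    (69 + 27 * w) * p ^ 2                        ∎
    where
    expand : ∀ D w → 100 * (D * (D * 1)) * ((2 + w) * 4 + ((2 + (2 + w)) * 1 + 1)) ≡ (500 * (D * D)) * w + 1300 * (D * D)
    expand = ℕSolver.solve-∀
    factor : ∀ P w → (27 * (P * P)) * w + 69 * (P * P) ≡ (69 + 27 * w) * (P * (P * 1))
    factor = ℕSolver.solve-∀

bounds : ∀ k → InBound (2 + k) × OutBound (2 + k)
bounds zero    = bounds-base
bounds (suc k) with bounds k
... | in-bound , out-bound =
  in-step (d ^ (2 + k)) (p ^ (2 + k)) (#in (2 + k)) (#out 1 (2 + k)) in-bound (out-bound 1) ,
  λ w → out-step (d ^ (2 + k)) (p ^ (2 + k)) w (#in (2 + k)) (#out (2 + w) (2 + k)) in-bound (out-bound (2 + w))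

-- The count relevant for T'(k + 1): #out 0 (k + 1) ≤ 3·cᵏ, because
-- 2·0.84 + 0.69 + 0.27·2 ≤ 3.
#out-bound : ∀ k → d ^ k * #out 0 (suc k) ≤ 3 * p ^ k
#out-bound zero          = ℕP.≤-refl
#out-bound (suc zero)    = numerals (λ p d → d * 1 * 13 ≤ 3 * (p * 1)) (ℕP.≤ᵇ⇒≤ _ _ tt)
#out-bound (suc (suc k)) with bounds k
... | in-bound , out-bound = ℕP.*-cancelˡ-≤ 100 (begin
  100 * (Y * (2 * a + b))              ≡⟨ regroup Y a b ⟩
  2 * (100 * Y * a) + 100 * Y * b      ≤⟨ ℕP.+-mono-≤ (ℕP.*-monoʳ-≤ 2 in-bound) (out-bound 2) ⟩
  2 * (84 * X) + (69 + 27 * 2) * X     ≡⟨ collect X ⟩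
  291 * X                              ≤⟨ ℕP.*-monoˡ-≤ X (ℕP.≤ᵇ⇒≤ 291 300 tt) ⟩
  300 * X                              ≡⟨ ℕP.*-assoc 100 3 X ⟩
  100 * (3 * X)                        ∎)
  where
  open ℕP.≤-Reasoning
  Y = d ^ (2 + k)
  X = p ^ (2 + k)
  a = #in (2 + k)
  b = #out 2 (2 + k)
  regroup : ∀ Y a b → 100 * (Y * (2 * a + b)) ≡ 2 * (100 * Y * a) + 100 * Y * b
  regroup = ℕSolver.solve-∀
  collect : ∀ X → 2 * (84 * X) + (69 + 27 * 2) * X ≡ 291 * X
  collect = ℕSolver.solve-∀

record PathConditions (m : ℕ) (A : Vec Bool (suc m)) (f : Vec (Maybe ℤ) (suc m))
                      (g : Fin (suc m) → ℤ) : Set where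
  field
    values    : ∀ (i : Fin m) → lookup f (suc i) ≡ (if lookup A (suc i) then just (g (suc i)) else nothing)
    lipschitz : ∀ u v → toℕ v ≡ suc (toℕ u) → ∣ g u - g v ∣ ≤ 1
    leave-A   : ∀ u v → toℕ v ≡ suc (toℕ u) → lookup A u ≡ true → lookup A v ≡ false → g v ℤ.≤ g u
    enter-A   : ∀ u v → toℕ v ≡ suc (toℕ u) → lookup A v ≡ true → lookup A u ≡ false → g u ℤ.≤ g v
open PathConditions

drop-first : ∀ {m a A f₀ f g} → PathConditions (suc m) (a ∷ A) (f₀ ∷ f) g → PathConditions m A f (g ∘ suc)
drop-first C = record
  { values    = λ i → values C (suc i)
  ; lipschitz = λ u v e → lipschitz C (suc u) (suc v) (cong suc e)
  ; leave-A   = λ u v e → leave-A C (suc u) (suc v) (cong suc e)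
  ; enter-A   = λ u v e → enter-A C (suc u) (suc v) (cong suc e) }

toWalk : ∀ m A f g → PathConditions m A f g → Walk (head A) (g zero) m (tail A) (tail f) (g ∘ suc)
toWalk zero    (a ∷ [])         (f₀ ∷ [])      g C = tt
toWalk (suc m) (a ∷ true ∷ A)  (f₀ ∷ f₁ ∷ f) g C =
  values C zero , lipschitz C zero (suc zero) refl , (λ a≡false → enter-A C zero (suc zero) refl refl a≡false) ,
  toWalk m (true ∷ A) (f₁ ∷ f) (g ∘ suc) (drop-first C)
toWalk (suc m) (a ∷ false ∷ A) (f₀ ∷ f₁ ∷ f) g C =
  values C zero , lipschitz C zero (suc zero) refl , (λ a≡true → leave-A C zero (suc zero) refl a≡true refl) ,
  toWalk m (false ∷ A) (f₁ ∷ f) (g ∘ suc) (drop-first C)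

true≢false : ¬ (true ≡ false)
true≢false ()

∈ₛ⇒true : ∀ {m} {i : Fin m} {A : Subset m} → i ∈ₛ A → lookup A i ≡ true
∈ₛ⇒true = VecP.[]=⇒lookup

false⇒∉ₛ : ∀ {m} {i : Fin m} {A : Subset m} → lookup A i ≡ false → i ∉ₛ A
false⇒∉ₛ A[i]≡false i∈A = true≢false (trans (sym (∈ₛ⇒true i∈A)) A[i]≡false)

prototype-conditions : ∀ n j A f → IsT'Prototype n j (A , f) →
                       Σ (Fin (suc n) → ℤ) λ g → PathConditions n A f g × g zero ≡ j
prototype-conditions n j A f ((dom , _ , g , (_ , lip , dir) , agree) , _ , f₀≡j) =
  g , conditions , MaybeP.just-injective (trans (sym (agree zero v₀∈A∪B)) f₀≡j)
  where
  v₀∈A∪B : zero ∈ₛ A ∪ ⁅ zero ⁆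
  v₀∈A∪B = SubsetP.x∈p∪q⁺ (inj₂ (SubsetP.x∈⁅x⁆ zero))
  values′ : ∀ i → lookup f (suc i) ≡ (if lookup A (suc i) then just (g (suc i)) else nothing)
  values′ i with lookup A (suc i) in A[i]
  ... | true  = agree (suc i) (SubsetP.p⊆p∪q ⁅ zero ⁆ (VecP.lookup⇒[]= (suc i) A A[i]))
  ... | false with lookup f (suc i) in f[i]
  ...   | nothing = refl
  ...   | just z with SubsetP.x∈p∪q⁻ A ⁅ zero ⁆ (proj₂ (dom (suc i)) (z , f[i]))
  ...     | inj₁ i∈A = ⊥-elim (false⇒∉ₛ A[i] i∈A)
  ...     | inj₂ i∈B with SubsetP.x∈⁅y⁆⇒x≡y zero i∈B
  ...       | ()
  conditions : PathConditions n A f g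
  conditions = record
    { values    = values′
    ; lipschitz = λ u v e → lip u v (inj₁ e)
    ; leave-A   = λ u v e Au Av → dir u v (inj₁ e) (VecP.lookup⇒[]= u A Au) (false⇒∉ₛ Av)
    ; enter-A   = λ u v e Av Au → dir v u (inj₂ e) (VecP.lookup⇒[]= v A Av) (false⇒∉ₛ Au) }

withStart : ∀ {n} → ℤ → Pattern n → Pattern (suc n)
withStart j (A , f) = (false ∷ A , just j ∷ f)

first-outside : ∀ {n} a (A : Subset n) → zero ∉ₛ (a ∷ A) → a ≡ false
first-outside true  A v₀∉A = ⊥-elim (v₀∉A (VecP.lookup⇒[]= zero (true ∷ A) refl))
first-outside false A _    = refl

prototype-listed : ∀ n j A f → IsT'Prototype n j (A , f) → (A , f) ∈ map (withStart j) (tailsOut j 0 n)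
prototype-listed n j (a ∷ A) (f₀ ∷ f) T'@(_ , v₀∉A , refl)
  with first-outside a A v₀∉A | prototype-conditions n j (a ∷ A) (f₀ ∷ f) T'
... | refl | g , C , refl =
  ∈-map⁺ (withStart (g zero))
    (tailsOut-complete n (g zero) 0 0 A f (g ∘ suc) (g zero) (sym (ℤP.+-identityʳ _)) z≤n
       (toWalk n (false ∷ A) (just (g zero) ∷ f) g C))

-- Powers of a fraction a / (1 + b), computed without normalisation: the
-- unnormalised fraction aᵏ / (1 + b)ᵏ, whose denominator is written as the
-- successor of its predecessor.
fractionᵘ-power : ℕ → ℕ → ℕ → ℚᵘ.ℚᵘ
fractionᵘ-power a b k = ℚᵘ.mkℚᵘ (+ (a ^ k)) (ℕ.pred (suc b ^ k))

suc-pred-power : ∀ b k → suc (ℕ.pred (suc b ^ k)) ≡ suc b ^ k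
suc-pred-power b k = ℕP.suc-pred (suc b ^ k) {{ℕP.m^n≢0 (suc b) k}}

fractionᵘ-power-suc : ∀ a b k →
  ℚᵘ.mkℚᵘ (+ a) b ℚᵘ.* fractionᵘ-power a b k ℚᵘ.≃ fractionᵘ-power a b (suc k)
fractionᵘ-power-suc a b k = ℚᵘ.*≡* (begin
  (+ a ℤ.* + A) ℤ.* + suc (ℕ.pred (suc b * B))   ≡⟨ cong₂ ℤ._*_ (sym (ℤP.pos-* a A)) (cong +_ (suc-pred-power b (suc k))) ⟩
  + (a * A) ℤ.* + (suc b * B)                    ≡⟨ cong (λ z → + (a * A) ℤ.* + (suc b * z)) (sym (suc-pred-power b k)) ⟩
  + (a * A) ℤ.* + (suc b * suc (ℕ.pred B))       ∎)
  where
  open ≡-Reasoning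
  A = a ^ k
  B = suc b ^ k

toℚᵘ-power : ∀ a b k → ℚ.toℚᵘ (((+ a) / suc b) ^ℚ k) ℚᵘ.≃ fractionᵘ-power a b k
toℚᵘ-power a b zero    = ℚᵘP.≃-refl
toℚᵘ-power a b (suc k) = begin-equality
  ℚ.toℚᵘ (c ℚ.* (c ^ℚ k))                     ≃⟨ ℚP.toℚᵘ-homo-* c (c ^ℚ k) ⟩
  ℚ.toℚᵘ c ℚᵘ.* ℚ.toℚᵘ (c ^ℚ k)               ≃⟨ ℚᵘP.*-cong (ℚP.toℚᵘ-fromℚᵘ (ℚᵘ.mkℚᵘ (+ a) b)) (toℚᵘ-power a b k) ⟩
  ℚᵘ.mkℚᵘ (+ a) b ℚᵘ.* fractionᵘ-power a b k  ≃⟨ fractionᵘ-power-suc a b k ⟩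
  fractionᵘ-power a b (suc k)                 ∎
  where
  open ℚᵘP.≤-Reasoning
  c = (+ a) / suc b

scaled-≤ᵘ : ∀ N M a b k → N * suc b ^ k ≤ M * a ^ k →
            ℚᵘ.mkℚᵘ (+ N) 0 ℚᵘ.≤ ℚᵘ.mkℚᵘ (+ M) 0 ℚᵘ.* fractionᵘ-power a b k
scaled-≤ᵘ N M a b k N≤M = ℚᵘ.*≤* (begin
  + N ℤ.* + suc (ℕ.pred B ℕ.+ 0 * suc (ℕ.pred B)) ≡⟨ cong (λ z → + N ℤ.* + z) (trans (cong suc (ℕP.+-identityʳ (ℕ.pred B))) (suc-pred-power b k)) ⟩
  + N ℤ.* + B                                     ≡⟨ ℤP.pos-* N B ⟨
  + (N * B)                                       ≤⟨ ℤ.+≤+ N≤M ⟩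
  + (M * A)                                       ≡⟨ ℤP.pos-* M A ⟩
  + M ℤ.* + A                                     ≡⟨ ℤP.*-identityʳ _ ⟨
  (+ M ℤ.* + A) ℤ.* + 1                           ∎)
  where
  open ℤP.≤-Reasoning
  A = a ^ k
  B = suc b ^ k

scaled-≤ : ∀ N M a b k → N * suc b ^ k ≤ M * a ^ k →
           (+ N) / 1 ℚ.≤ ((+ M) / 1) ℚ.* (((+ a) / suc b) ^ℚ k)
scaled-≤ N M a b k N≤M = ℚP.toℚᵘ-cancel-≤ (begin
  ℚ.toℚᵘ ((+ N) / 1)                                   ≃⟨ ℚP.toℚᵘ-fromℚᵘ (ℚᵘ.mkℚᵘ (+ N) 0) ⟩
  ℚᵘ.mkℚᵘ (+ N) 0                                      ≤⟨ scaled-≤ᵘ N M a b k N≤M ⟩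
  ℚᵘ.mkℚᵘ (+ M) 0 ℚᵘ.* fractionᵘ-power a b k           ≃⟨ ℚᵘP.*-cong (ℚP.toℚᵘ-fromℚᵘ (ℚᵘ.mkℚᵘ (+ M) 0)) (toℚᵘ-power a b k) ⟨
  ℚ.toℚᵘ ((+ M) / 1) ℚᵘ.* ℚ.toℚᵘ (((+ a) / suc b) ^ℚ k) ≃⟨ ℚP.toℚᵘ-homo-* ((+ M) / 1) (((+ a) / suc b) ^ℚ k) ⟨
  ℚ.toℚᵘ (((+ M) / 1) ℚ.* (((+ a) / suc b) ^ℚ k))       ∎)
  where open ℚᵘP.≤-Reasoning

^ℚ-nonNeg : ∀ a → 0ℚ ℚ.≤ a → ∀ k → 0ℚ ℚ.≤ a ^ℚ k
^ℚ-nonNeg a 0≤a zero    = ℚP.nonNegative⁻¹ ℚ.1ℚ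
^ℚ-nonNeg a 0≤a (suc k) = ℚP.≤-trans (ℚP.≤-reflexive (sym (ℚP.*-zeroˡ (a ^ℚ k))))
  (ℚP.*-monoʳ-≤-nonNeg (a ^ℚ k) {{ℚ.nonNegative (^ℚ-nonNeg a 0≤a k)}} 0≤a)

^ℚ-mono-≤ : ∀ a b → 0ℚ ℚ.≤ a → a ℚ.≤ b → ∀ k → a ^ℚ k ℚ.≤ b ^ℚ k
^ℚ-mono-≤ a b 0≤a a≤b zero    = ℚP.≤-refl
^ℚ-mono-≤ a b 0≤a a≤b (suc k) = ℚP.≤-trans
  (ℚP.*-monoʳ-≤-nonNeg (a ^ℚ k) {{ℚ.nonNegative (^ℚ-nonNeg a 0≤a k)}} a≤b)
  (ℚP.*-monoˡ-≤-nonNeg b {{ℚ.nonNegative (ℚP.≤-trans 0≤a a≤b)}} (^ℚ-mono-≤ a b 0≤a a≤b k))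

-- T'(k + 1) ≤ 3·4.373ᵏ, cleared of denominators: a duplicate-free list of
-- T'-prototypes is no longer than the candidate list.
T'-count : ∀ k j (L : List (Subset (suc (suc k)) × PFun (suc (suc k)))) →
           Unique L → All (IsT'Prototype (suc k) j) L → length L * 1000 ^ k ≤ 3 * 4373 ^ k
T'-count k j L unique prototypes = begin
  length L * 1000 ^ k        ≤⟨ ℕP.*-monoˡ-≤ (1000 ^ k) L≤#out ⟩
  #out 0 n * 1000 ^ k        ≡⟨ ℕP.*-comm (#out 0 n) (1000 ^ k) ⟩
  1000 ^ k * #out 0 n        ≤⟨ subst₂ (λ p d → d ^ k * #out 0 n ≤ 3 * p ^ k) p≡4373 d≡1000 (#out-bound k) ⟩
  3 * 4373 ^ k               ∎
  where
  open ℕP.≤-Reasoning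
  n = suc k
  candidates = map (withStart j) (tailsOut j 0 n)
  L≤#out : length L ≤ #out 0 n
  L≤#out = ℕP.≤-trans (unique-⊆-length L candidates unique
                         (λ {(A , f)} x∈L → prototype-listed n j A f (All.lookup prototypes x∈L)))
                      (ℕP.≤-reflexive (trans (ListP.length-map (withStart j) (tailsOut j 0 n))
                                             (length-tailsOut j 0 n)))

lemma16 : Σ ℚ λ ε₀ → (0ℚ ℚ.< ε₀) ×
              (∀ (ε : ℚ) → 0ℚ ℚ.< ε → ε ℚ.< ε₀ →
                ∀ (n : ℕ) → 1 ℕ.≤ n → ∀ (j : ℤ) →
                ∀ (L : List (Subset (suc n) × PFun (suc n))) →
                Unique L → All (IsT'Prototype n j) L →
                (+ length L) / 1 ℚ.≤ ((+ 3) / 1) ℚ.* ((((+ 4383) / 1000) ℚ.- ε) ^ℚ (n ∸ 1)))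
lemma16 = (+ 1) / 100 , ℚP.positive⁻¹ _ , bound
  where
  bound : ∀ (ε : ℚ) → 0ℚ ℚ.< ε → ε ℚ.< (+ 1) / 100 →
          ∀ (n : ℕ) → 1 ℕ.≤ n → ∀ (j : ℤ) →
          ∀ (L : List (Subset (suc n) × PFun (suc n))) →
          Unique L → All (IsT'Prototype n j) L →
          (+ length L) / 1 ℚ.≤ ((+ 3) / 1) ℚ.* ((((+ 4383) / 1000) ℚ.- ε) ^ℚ (n ∸ 1))
  bound ε _ ε<ε₀ (suc k) _ j L unique prototypes = ℚP.≤-trans
    (scaled-≤ (length L) 3 4373 999 k (T'-count k j L unique prototypes))
    (ℚP.*-monoˡ-≤-nonNeg ((+ 3) / 1) (^ℚ-mono-≤ _ _ (ℚP.nonNegative⁻¹ _) c≤4383-ε k))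
    where
    c≤4383-ε : (+ 4373) / 1000 ℚ.≤ ((+ 4383) / 1000) ℚ.- ε
    c≤4383-ε = ℚP.+-monoʳ-≤ ((+ 4383) / 1000) (ℚP.neg-antimono-≤ (ℚP.<⇒≤ ε<ε₀))
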